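{- Let $0<\varepsilon<1$, $m=\lfloor 2\varepsilon^{ -1}\rfloor$, and let $q=p_{1}^{\alpha_{1}}\cdots p_{s}^{\alpha_{s}}$ be the prime factorization of an integer $q>1$, with $d=p_1\cdots p_s$. Put $\beta_{r}=\lfloor\varepsilon\alpha_{r}\rfloor$ for $r=1,\dots,s$ and $q_{\varepsilon}=d\,p_{1}^{\beta_{1}}\cdots p_{s}^{\beta_{s}}$. Then for every integer $z$, the number $1+zq_\varepsilon$ is coprime to $q$ and $$(1+zq_{\varepsilon})^{*}\equiv 1-zq_{\varepsilon}+(zq_{\varepsilon})^{2}-\dots+(-1)^{m}(zq_{\varepsilon})^{m}\pmod q,$$ where $x^{*}$ denotes the inverse of $x$ modulo $q$.
   Context: For an integer $x$ coprime to $q$, $x^{*}$ is any integer with $xx^{*}\equiv 1\pmod q$; the congruence is understood modulo $q$.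
   Formalization: The parameter ε ranges over the rationals with $0<\varepsilon<1$. -}

module Defs where

open import Data.Nat as ℕ using (ℕ; zero; suc)
open import Data.Fin using (Fin; zero; suc)
open import Data.Integer as ℤ using (ℤ; +_)
open import Data.Integer.Divisibility using (_∣_)

∏ : (s : ℕ) → (Fin s → ℕ) → ℕ
∏ zero    f = 1
∏ (suc s) f = f zero ℕ.* ∏ s (λ i → f (suc i))

altSum : ℕ → ℤ → ℤ
altSum zero    y = ℤ.1ℤ
altSum (suc m) y = altSum m y ℤ.+ (ℤ.-1ℤ ℤ.^ suc m) ℤ.* (y ℤ.^ suc m)

infix 4 _≡_[mod_]
_≡_[mod_] : ℤ → ℤ → ℕ → Set
a ≡ b [mod q ] = (+ q) ∣ (a ℤ.- b)

{-# OPTIONS --safe #-}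
module Submission where

-- With y = z qε, every prime power p^α of q divides qε^(m+1): the exponent of p
-- there is (1 + ⌊εα⌋)(m + 1) > εα · 2/ε = 2α.  So y^(m+1) ≡ 0 (mod q), and the
-- telescoping identity (1 + y)(1 - y + ⋯ + (-y)^m) = 1 - (-y)^(m+1) shows that the
-- alternating sum is an inverse of 1 + y modulo q.  An element with an inverse
-- is coprime to q, and its inverse is unique modulo q.

open import Defs
open import Data.Nat as ℕ using (ℕ; suc; _<_; _≤_; _/_)
open import Data.Fin using (Fin; zero; suc)
open import Data.Nat.Primality using (Prime)
open import Data.Nat.Coprimality using (Coprime)
open import Function.Definitions using (Injective)
import Relation.Binary.PropositionalEquality as P
open import Data.Product using (_×_; _,_)
open import Data.Integer as ℤ using (ℤ; +_; ∣_∣)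
import Data.Nat.Properties as ℕP
import Data.Nat.Divisibility as ℕD
import Data.Nat.DivMod as ℕDM
import Data.Integer.Properties as ℤP
import Data.Integer.Divisibility as ℤU
import Data.Integer.Divisibility.Signed as ℤD
open import Data.Nat.Solver using () renaming (module +-*-Solver to ℕSolver)
open import Data.Integer.Solver using () renaming (module +-*-Solver to ℤSolver)

open P using (_≡_; refl)

^-distrib-* : ∀ x y k → (x ℕ.* y) ℕ.^ k ≡ x ℕ.^ k ℕ.* y ℕ.^ k
^-distrib-* x y ℕ.zero    = refl
^-distrib-* x y (suc k) = P.trans (P.cong (x ℕ.* y ℕ.*_) (^-distrib-* x y k))
                                  (interchange x y (x ℕ.^ k) (y ℕ.^ k))
  where
  open ℕSolver
  interchange : ∀ x y u v → x ℕ.* y ℕ.* (u ℕ.* v) ≡ x ℕ.* u ℕ.* (y ℕ.* v)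
  interchange = solve 4 (λ x y u v → x :* y :* (u :* v) := x :* u :* (y :* v)) refl

^-monoʳ-∣ : ∀ x {k n} → k ≤ n → x ℕ.^ k ℕD.∣ x ℕ.^ n
^-monoʳ-∣ x {k} {n} k≤n = P.subst (x ℕ.^ k ℕD.∣_) x^k*x^[n∸k]≡x^n (ℕD.m∣m*n _)
  where
  x^k*x^[n∸k]≡x^n : x ℕ.^ k ℕ.* x ℕ.^ (n ℕ.∸ k) ≡ x ℕ.^ n
  x^k*x^[n∸k]≡x^n = P.trans (P.sym (ℕP.^-distribˡ-+-* x k (n ℕ.∸ k)))
                            (P.cong (x ℕ.^_) (ℕP.m+[n∸m]≡n k≤n))

∏-^ : ∀ s (f : Fin s → ℕ) k → ∏ s f ℕ.^ k ≡ ∏ s (λ r → f r ℕ.^ k)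
∏-^ ℕ.zero    f k = ℕP.^-zeroˡ k
∏-^ (suc s) f k = P.trans (^-distrib-* (f zero) _ k)
                          (P.cong (f zero ℕ.^ k ℕ.*_) (∏-^ s (λ r → f (suc r)) k))

∏-mono-∣ : ∀ s {f g : Fin s → ℕ} → (∀ r → f r ℕD.∣ g r) → ∏ s f ℕD.∣ ∏ s g
∏-mono-∣ ℕ.zero    f∣g = ℕD.∣-refl
∏-mono-∣ (suc s) f∣g = ℕD.*-pres-∣ (f∣g zero) (∏-mono-∣ s (λ r → f∣g (suc r)))

∏-^-∣-∏-^ : ∀ s (p α e : Fin s → ℕ) k → (∀ r → α r ≤ e r ℕ.* k) →
            ∏ s (λ r → p r ℕ.^ α r) ℕD.∣ ∏ s (λ r → p r ℕ.^ e r) ℕ.^ k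
∏-^-∣-∏-^ s p α e k α≤ek = P.subst (_ ℕD.∣_) (P.sym (∏-^ s _ k))
  (∏-mono-∣ s (λ r → P.subst (_ ℕD.∣_) (P.sym (ℕP.^-*-assoc (p r) (e r) k))
                                        (^-monoʳ-∣ (p r) (α≤ek r))))

m<[1+m/n]*n : ∀ m n .{{_ : ℕ.NonZero n}} → m < suc (m / n) ℕ.* n
m<[1+m/n]*n m n = P.subst (_< suc (m / n) ℕ.* n) (P.sym (ℕDM.m≡m%n+[m/n]*n m n))
                          (ℕP.+-monoˡ-< ((m / n) ℕ.* n) (ℕDM.m%n<n m n))

2α<[1+⌊aα/b⌋]*[1+⌊2b/a⌋] : ∀ a b .{{_ : ℕ.NonZero a}} .{{_ : ℕ.NonZero b}} α →
  2 ℕ.* α < suc ((a ℕ.* α) / b) ℕ.* suc ((2 ℕ.* b) / a)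
2α<[1+⌊aα/b⌋]*[1+⌊2b/a⌋] a b α = ℕP.*-cancelˡ-< (a ℕ.* b) _ _
  (P.subst₂ _<_ (regroupˡ a b α) (regroupʳ a b (suc ((a ℕ.* α) / b)) (suc ((2 ℕ.* b) / a)))
    (ℕP.*-mono-< (m<[1+m/n]*n (a ℕ.* α) b) (m<[1+m/n]*n (2 ℕ.* b) a)))
  where
  open ℕSolver
  regroupˡ : ∀ a b α → a ℕ.* α ℕ.* (2 ℕ.* b) ≡ a ℕ.* b ℕ.* (2 ℕ.* α)
  regroupˡ = solve 3 (λ a b α → a :* α :* (con 2 :* b) := a :* b :* (con 2 :* α)) refl
  regroupʳ : ∀ a b x y → x ℕ.* b ℕ.* (y ℕ.* a) ≡ a ℕ.* b ℕ.* (x ℕ.* y)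
  regroupʳ = solve 4 (λ a b x y → x :* b :* (y :* a) := a :* b :* (x :* y)) refl

abs-^ : ∀ i k → ∣ i ℤ.^ k ∣ ≡ ∣ i ∣ ℕ.^ k
abs-^ i ℕ.zero    = refl
abs-^ i (suc k) = P.trans (ℤP.abs-* i (i ℤ.^ k)) (P.cong (∣ i ∣ ℕ.*_) (abs-^ i k))

∣n^k⇒∣[z*n]^k : ∀ {q n} z k → q ℕD.∣ n ℕ.^ k → + q ℤU.∣ (z ℤ.* + n) ℤ.^ k
∣n^k⇒∣[z*n]^k {q} {n} z k q∣n^k =
  P.subst (q ℕD.∣_) (P.sym ∣[z*n]^k∣≡∣z∣^k*n^k) (ℕD.∣-trans q∣n^k (ℕD.n∣m*n (∣ z ∣ ℕ.^ k)))
  where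
  open P.≡-Reasoning
  ∣[z*n]^k∣≡∣z∣^k*n^k : ∣ (z ℤ.* + n) ℤ.^ k ∣ ≡ ∣ z ∣ ℕ.^ k ℕ.* n ℕ.^ k
  ∣[z*n]^k∣≡∣z∣^k*n^k = begin
    ∣ (z ℤ.* + n) ℤ.^ k ∣   ≡⟨ abs-^ (z ℤ.* + n) k ⟩
    ∣ z ℤ.* + n ∣ ℕ.^ k     ≡⟨ P.cong (ℕ._^ k) (ℤP.abs-* z (+ n)) ⟩
    (∣ z ∣ ℕ.* n) ℕ.^ k     ≡⟨ ^-distrib-* ∣ z ∣ n k ⟩
    ∣ z ∣ ℕ.^ k ℕ.* n ℕ.^ k ∎

[1+y]*altSum≡1-[-1]^[1+m]*y^[1+m] : ∀ m y →
  (ℤ.1ℤ ℤ.+ y) ℤ.* altSum m y ≡ ℤ.1ℤ ℤ.- (ℤ.-1ℤ ℤ.^ suc m) ℤ.* (y ℤ.^ suc m)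
[1+y]*altSum≡1-[-1]^[1+m]*y^[1+m] ℕ.zero    y = base y
  where
  open ℤSolver
  base : ∀ y → (ℤ.1ℤ ℤ.+ y) ℤ.* ℤ.1ℤ ≡ ℤ.1ℤ ℤ.- (ℤ.-1ℤ ℤ.* ℤ.1ℤ) ℤ.* (y ℤ.* ℤ.1ℤ)
  base = solve 1 (λ y → (con ℤ.1ℤ :+ y) :* con ℤ.1ℤ
                        := con ℤ.1ℤ :- (con ℤ.-1ℤ :* con ℤ.1ℤ) :* (y :* con ℤ.1ℤ)) refl
[1+y]*altSum≡1-[-1]^[1+m]*y^[1+m] (suc m) y = begin
  (ℤ.1ℤ ℤ.+ y) ℤ.* (altSum m y ℤ.+ u ℤ.* v)
    ≡⟨ ℤP.*-distribˡ-+ (ℤ.1ℤ ℤ.+ y) (altSum m y) (u ℤ.* v) ⟩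
  (ℤ.1ℤ ℤ.+ y) ℤ.* altSum m y ℤ.+ (ℤ.1ℤ ℤ.+ y) ℤ.* (u ℤ.* v)
    ≡⟨ P.cong (ℤ._+ (ℤ.1ℤ ℤ.+ y) ℤ.* (u ℤ.* v)) ([1+y]*altSum≡1-[-1]^[1+m]*y^[1+m] m y) ⟩
  ℤ.1ℤ ℤ.- u ℤ.* v ℤ.+ (ℤ.1ℤ ℤ.+ y) ℤ.* (u ℤ.* v)
    ≡⟨ telescope y u v ⟩
  ℤ.1ℤ ℤ.- (ℤ.-1ℤ ℤ.* u) ℤ.* (y ℤ.* v) ∎
  where
  open P.≡-Reasoning
  open ℤSolver
  u = ℤ.-1ℤ ℤ.^ suc m
  v = y ℤ.^ suc m
  telescope : ∀ y u v → ℤ.1ℤ ℤ.- u ℤ.* v ℤ.+ (ℤ.1ℤ ℤ.+ y) ℤ.* (u ℤ.* v)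
                        ≡ ℤ.1ℤ ℤ.- (ℤ.-1ℤ ℤ.* u) ℤ.* (y ℤ.* v)
  telescope = solve 3 (λ y u v → con ℤ.1ℤ :- u :* v :+ (con ℤ.1ℤ :+ y) :* (u :* v)
                                 := con ℤ.1ℤ :- (con ℤ.-1ℤ :* u) :* (y :* v)) refl

[1+y]*altSum≡1 : ∀ q m y → + q ℤU.∣ y ℤ.^ suc m →
                 (ℤ.1ℤ ℤ.+ y) ℤ.* altSum m y ≡ ℤ.1ℤ [mod q ]
[1+y]*altSum≡1 q m y q∣y^[1+m] = ℤD.∣⇒∣ᵤ (P.subst (+ q ℤD.∣_) (P.sym [1+y]*S-1≡-c)
  (ℤD.∣m⇒∣-m (ℤD.∣n⇒∣m*n (ℤ.-1ℤ ℤ.^ suc m) (ℤD.∣ᵤ⇒∣ q∣y^[1+m]))))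
  where
  c = (ℤ.-1ℤ ℤ.^ suc m) ℤ.* (y ℤ.^ suc m)
  1-c-1≡-c : ∀ c → ℤ.1ℤ ℤ.- c ℤ.- ℤ.1ℤ ≡ ℤ.- c
  1-c-1≡-c = solve 1 (λ c → con ℤ.1ℤ :- c :- con ℤ.1ℤ := :- c) refl
    where open ℤSolver
  [1+y]*S-1≡-c : (ℤ.1ℤ ℤ.+ y) ℤ.* altSum m y ℤ.- ℤ.1ℤ ≡ ℤ.- c
  [1+y]*S-1≡-c = P.trans (P.cong (ℤ._- ℤ.1ℤ) ([1+y]*altSum≡1-[-1]^[1+m]*y^[1+m] m y))
                         (1-c-1≡-c c)

invertible⇒coprime : ∀ {q} u v → u ℤ.* v ≡ ℤ.1ℤ [mod q ] → Coprime ∣ u ∣ q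
invertible⇒coprime {q} u v uv≡1 {i} (i∣u , i∣q) = ℕD.∣1⇒≡1 (ℤD.∣⇒∣ᵤ i∣1)
  where
  uv-[uv-1]≡1 : ∀ u v → u ℤ.* v ℤ.- (u ℤ.* v ℤ.- ℤ.1ℤ) ≡ ℤ.1ℤ
  uv-[uv-1]≡1 = solve 2 (λ u v → u :* v :- (u :* v :- con ℤ.1ℤ) := con ℤ.1ℤ) refl
    where open ℤSolver
  i∣1 : + i ℤD.∣ ℤ.1ℤ
  i∣1 = P.subst (+ i ℤD.∣_) (uv-[uv-1]≡1 u v)
    (ℤD.∣m∣n⇒∣m-n (ℤD.∣m⇒∣m*n v (ℤD.∣ᵤ⇒∣ {i = u} i∣u))
                  (ℤD.∣-trans (ℤD.∣ᵤ⇒∣ {i = + q} i∣q) (ℤD.∣ᵤ⇒∣ {i = u ℤ.* v ℤ.- ℤ.1ℤ} uv≡1)))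

inverse-unique : ∀ {q} u v w → u ℤ.* v ≡ ℤ.1ℤ [mod q ] → u ℤ.* w ≡ ℤ.1ℤ [mod q ] →
                 w ≡ v [mod q ]
inverse-unique {q} u v w uv≡1 uw≡1 = ℤD.∣⇒∣ᵤ (P.subst (+ q ℤD.∣_) (regroup u v w)
  (ℤD.∣m∣n⇒∣m-n (ℤD.∣n⇒∣m*n v (ℤD.∣ᵤ⇒∣ uw≡1)) (ℤD.∣n⇒∣m*n w (ℤD.∣ᵤ⇒∣ uv≡1))))
  where
  regroup : ∀ u v w → v ℤ.* (u ℤ.* w ℤ.- ℤ.1ℤ) ℤ.- w ℤ.* (u ℤ.* v ℤ.- ℤ.1ℤ) ≡ w ℤ.- v
  regroup = solve 3 (λ u v w → v :* (u :* w :- con ℤ.1ℤ) :- w :* (u :* v :- con ℤ.1ℤ)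
                               := w :- v) refl
    where open ℤSolver

lemma1 : (a b : ℕ) → .{{_ : ℕ.NonZero a}} → .{{_ : ℕ.NonZero b}} → a < b →
    (s : ℕ) (p : Fin s → ℕ) (α : Fin s → ℕ) →
    (∀ r → Prime (p r)) → Injective P._≡_ P._≡_ p → (∀ r → 1 ≤ α r) →
    (q : ℕ) → q P.≡ ∏ s (λ r → p r ℕ.^ α r) → 1 < q →
    let m = (2 ℕ.* b) / a
        qε = ∏ s (λ r → p r ℕ.^ (1 ℕ.+ (a ℕ.* α r) / b))
    in (z : ℤ) →
       Coprime ∣ ℤ.1ℤ ℤ.+ z ℤ.* + qε ∣ q
       × ((x* : ℤ) → ((ℤ.1ℤ ℤ.+ z ℤ.* + qε) ℤ.* x* ≡ ℤ.1ℤ [mod q ]) →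
            (x* ≡ altSum m (z ℤ.* + qε) [mod q ]))
lemma1 a b _ s p α _ _ _ q refl _ z =
  invertible⇒coprime u S uS≡1 , λ x* ux*≡1 → inverse-unique u S x* uS≡1 ux*≡1
  where
  m = (2 ℕ.* b) / a
  e = λ r → 1 ℕ.+ (a ℕ.* α r) / b
  qε = ∏ s (λ r → p r ℕ.^ e r)
  y = z ℤ.* + qε
  u = ℤ.1ℤ ℤ.+ y
  S = altSum m y
  q∣qε^[1+m] : q ℕD.∣ qε ℕ.^ suc m
  q∣qε^[1+m] = ∏-^-∣-∏-^ s p α e (suc m) (λ r →
    ℕP.≤-trans (ℕP.m≤n*m (α r) 2) (ℕP.<⇒≤ (2α<[1+⌊aα/b⌋]*[1+⌊2b/a⌋] a b (α r))))
  q∣y^[1+m] : + q ℤU.∣ y ℤ.^ suc m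
  q∣y^[1+m] = ∣n^k⇒∣[z*n]^k z (suc m) q∣qε^[1+m]
  uS≡1 : u ℤ.* S ≡ ℤ.1ℤ [mod q ]
  uS≡1 = [1+y]*altSum≡1 q m y q∣y^[1+m]
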